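{- Let $m\ge 1$ and $n\ge 0$ be integers. The number of partitions $\lambda$ of $n$ having a $0$-fixed hook in the $m$th column (i.e. for which there is a row index $i$ with $\lambda_i\ge m$ and $h_{i,m}(\lambda)=i$) equals \[ \sum_{L\ge 1} \#\Big\{(\mu,\nu)\ :\ |\mu|+|\nu|=n,\ \text{the part } L \text{ appears exactly } L+m-1 \text{ times in } \mu,\ \text{and none of } L+1,L+2,\ldots,L+2m-2 \text{ is a part of } \mu\Big\}, \] where $\mu$ ranges over all partitions (the parts of the "first color") and $\nu$ ranges over all partitions all of whose parts lie in $\{1,2,\ldots,m-1\}$ (the parts of the "second color"). Equivalently, this is the total number of times, across all partitions of $n$ with two colors of parts $1,2,\ldots,m-1$, that some part of size $L$ appears exactly $L+m-1$ times in the first color while $L+1,\ldots,L+2m-2$ are not parts in the first color.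
   Context: A partition $\lambda=(\lambda_1\ge\lambda_2\ge\cdots\ge\lambda_r>0)$ of $n$ has Young diagram with cells $(i,j)$, $1\le i\le r$, $1\le j\le\lambda_i$; $\lambda'$ denotes the conjugate partition. The hook length of the cell $(i,j)$ is $h_{i,j}(\lambda)=\lambda_i+\lambda'_j-i-j+1$. For an integer $h$, $\lambda$ has an $h$-fixed hook in the $m$th column if there is a row $i$ with $\lambda_i\ge m$ and $h_{i,m}(\lambda)=i+h$. A "partition of $n$ with two colors of parts $1,\ldots,m-1$" is a partition of $n$ in which each part of size at most $m-1$ carries one of two colors (first or second) and every part of size at least $m$ carries the first color. -}

module Defs where

open import Data.Nat using (ℕ; zero; suc; _+_; _*_; _∸_; _≤ᵇ_; _≡ᵇ_; _<ᵇ_)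
open import Data.Nat.ListAction using (sum)
open import Data.Bool using (Bool; true; false; _∧_; _∨_; not; T; if_then_else_)
open import Data.List using (List; []; _∷_)
open import Data.Product using (Σ; _×_)

-- A partition is represented as a list of its parts in weakly decreasing
-- order, all parts positive:  λ = (λ₁ ≥ λ₂ ≥ ⋯ ≥ λ_r > 0)  is  λ₁ ∷ λ₂ ∷ ⋯ ∷ λ_r ∷ [].
-- Predicates are Bool-valued so that their proofs (T b) are unique.

allPos : List ℕ → Bool
allPos []       = true
allPos (x ∷ xs) = (1 ≤ᵇ x) ∧ allPos xs

decreasing : List ℕ → Bool
decreasing []           = true
decreasing (x ∷ [])     = true
decreasing (x ∷ y ∷ xs) = (y ≤ᵇ x) ∧ decreasing (y ∷ xs)

isPartitionOf : ℕ → List ℕ → Bool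
isPartitionOf n xs = allPos xs ∧ decreasing xs ∧ (sum xs ≡ᵇ n)

partsBelow : ℕ → List ℕ → Bool
partsBelow m []       = true
partsBelow m (x ∷ xs) = (x <ᵇ m) ∧ partsBelow m xs

conj : List ℕ → ℕ → ℕ
conj []       j = 0
conj (x ∷ xs) j = (if j ≤ᵇ x then 1 else 0) + conj xs j

mult : ℕ → List ℕ → ℕ
mult L []       = 0
mult L (x ∷ xs) = (if x ≡ᵇ L then 1 else 0) + mult L xs

isPart : ℕ → List ℕ → Bool
isPart k []       = false
isPart k (x ∷ xs) = (x ≡ᵇ k) ∨ isPart k xs

-- hook length of cell (i,j) (1-based), valid when λ_i ≥ j:
--   h_{i,j} = λ_i + λ'_j - i - j + 1.
-- The condition h_{i,m}(λ) = i + h (here h = 0) is stated without truncated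
-- subtraction as  λ_i + λ'_m + 1 = 2i + m .
-- zfhFrom i λ m λfull : scan rows of λfull starting at row index i (1-based),
-- the remaining rows being λ.
zfhFrom : ℕ → List ℕ → ℕ → List ℕ → Bool
zfhFrom i []       m full = false
zfhFrom i (x ∷ xs) m full =
  ((m ≤ᵇ x) ∧ ((x + conj full m + 1) ≡ᵇ (i + i + m))) ∨ zfhFrom (suc i) xs m full

hasZeroFixedHook : ℕ → List ℕ → Bool
hasZeroFixedHook m xs = zfhFrom 1 xs m xs

noPartsIn : ℕ → ℕ → List ℕ → Bool
noPartsIn L zero    μ = true
noPartsIn L (suc k) μ = not (isPart (L + suc k) μ) ∧ noPartsIn L k μ

LHS : ℕ → ℕ → Set
LHS m n = Σ (List ℕ) λ lam → T (isPartitionOf n lam ∧ hasZeroFixedHook m lam)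

-- Its cardinality is the sum over L ≥ 1.
RHS : ℕ → ℕ → Set
RHS m n = Σ ℕ λ L → Σ (List ℕ) λ μ → Σ (List ℕ) λ ν →
  T ( (1 ≤ᵇ L)
    ∧ isPartitionOf (sum μ) μ
    ∧ isPartitionOf (sum ν) ν ∧ partsBelow m ν
    ∧ ((sum μ + sum ν) ≡ᵇ n)
    ∧ (mult L μ ≡ᵇ (L + m ∸ 1))
    ∧ noPartsIn L (m + m ∸ 2) μ )

module Submission where

-- A partition λ with a 0-fixed hook in row i of column m is cut along that row: its length is
-- m + k for some k, the rows above it are at least m + k, below it come d rows in [m, m + k] and
-- then the parts below m, which form the second-colour partition ν. Since
-- λ'_m = (i − 1) + 1 + d, the hook equation λ_i + λ'_m + 1 = 2i + m says exactly i − 1 = k + d.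
-- On the right-hand side, with L = k + 1, the first-colour partition μ consists of d parts at
-- least L + 2m − 1, then L + m − 1 copies of L, then parts below L. In both families the
-- smallest member for given (k, d) has the same size, and what remains is, on the left, a
-- partition into at most k + d parts together with one inside a d × k box, and on the right
-- a partition into parts at most k together with one into at most d parts. These are matched
-- by a weight-preserving bijection, the bijective form of
-- [k + d choose d]_q / (q)_{k+d} = 1 / ((q)_k (q)_d).

open import Data.Bool using (true; false; T; _∧_; not; if_then_else_)
open import Data.Bool.Properties using (T-∧; T-∨; T-irrelevant)
open import Data.Empty using (⊥; ⊥-elim)
open import Data.List using (List; []; _∷_; _++_; _∷ʳ_; length; replicate; reverse; takeWhile; dropWhile)
open import Data.List.Properties
  using (length-replicate; length-++; length-reverse; reverse-++; reverse-involutive; unfold-reverse;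
         ∷-injective; ∷-injectiveˡ; ∷-injectiveʳ; ++-assoc; ++-cancelˡ; takeWhile++dropWhile)
open import Data.List.Relation.Unary.All using (All; []; _∷_)
import Data.List.Relation.Unary.All as All
open import Data.List.Relation.Unary.All.Properties using (++⁺; replicate⁺; all-takeWhile; takeWhile⁺)
open import Data.Nat
  using (ℕ; zero; suc; _+_; _*_; _∸_; _⊔_; _≤_; _<_; _≥_; z≤n; s≤s; _≤?_; _<?_; _≟_;
         _≡ᵇ_; _≤ᵇ_)
open import Data.Nat.ListAction using (sum)
open import Data.Nat.ListAction.Properties using (sum-++)
open import Data.Nat.Properties
open import Data.Nat.Tactic.RingSolver using (solve-∀)
open import Data.Product using (Σ; _×_; _,_; proj₁; proj₂; ∃-syntax; map)
open import Data.Sum using (_⊎_; inj₁; inj₂)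
open import Data.Unit using (⊤; tt)
open import Data.Vec using (Vec; []; _∷_)
open import Function using (_∘_)
open import Function.Bundles using (_↔_; _⇔_; mk↔ₛ′; mk⇔; Equivalence)
open import Function.Properties.Inverse using (↔-trans)
open import Relation.Binary.PropositionalEquality
open import Relation.Binary.PropositionalEquality.Properties using (subst-subst-sym; subst-sym-subst)
open import Relation.Nullary using (Irrelevant; yes; no; contradiction)
open import Relation.Nullary.Decidable using (dec-true; dec-false)
open ≡-Reasoning

open import Defs

-- The box bijection

-- x ∷ v : Vec ℕ N lists how often the parts N, N − 1, …, 1 occur in a partition; weight is its size.
weight : ∀ {N} → Vec ℕ N → ℕ
weight []              = 0
weight {suc N} (x ∷ v) = suc N * x + weight v

weight-subst : ∀ {N N′} (e : N ≡ N′) (v : Vec ℕ N) → weight (subst (Vec ℕ) e v) ≡ weight v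
weight-subst refl v = refl

bump : ∀ {N} → ℕ → Vec ℕ (suc N) → Vec ℕ (suc N)
bump t (x ∷ v) = t + x ∷ v

weight-bump : ∀ {N} t (v : Vec ℕ (suc N)) → weight (bump t v) ≡ suc N * t + weight v
weight-bump {N} t (x ∷ v) = begin
  suc N * (t + x) + weight v          ≡⟨ cong (_+ weight v) (*-distribˡ-+ (suc N) t x) ⟩
  suc N * t + suc N * x + weight v    ≡⟨ +-assoc (suc N * t) _ _ ⟩
  suc N * t + (suc N * x + weight v)  ∎

-- Partitions with at most l parts, all at most k: inj₁ removes a part equal to k, inj₂ says
-- that no part equals k.
Box : ℕ → ℕ → Set
Box l       zero    = ⊤
Box zero    (suc k) = ⊤
Box (suc l) (suc k) = Box l (suc k) ⊎ Box (suc l) k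

boxWeight : ∀ {l k} → Box l k → ℕ
boxWeight {l}     {zero}  _        = 0
boxWeight {zero}  {suc k} _        = 0
boxWeight {suc l} {suc k} (inj₁ b) = suc k + boxWeight b
boxWeight {suc l} {suc k} (inj₂ b) = boxWeight b

coreWeight : ∀ {k l} → Vec ℕ (k + l) × Box l k → ℕ
coreWeight (z , b) = weight z + boxWeight b

pairWeight : ∀ {k l} → Vec ℕ k × Vec ℕ l → ℕ
pairWeight (p , s) = weight p + weight s

-- A part (k + 1) + (l + 1) splits into the parts k + 1 and l + 1, and a part k + 1 of the box
-- becomes one more part k + 1.
toPair : ∀ k l → Vec ℕ (k + l) × Box l k → Vec ℕ k × Vec ℕ l
toPair zero    l       (z , _)          = [] , z
toPair (suc k) zero    (z , _)          = subst (Vec ℕ) (+-identityʳ (suc k)) z , []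
toPair (suc k) (suc l) (t ∷ z , inj₁ b) =
  map (bump (suc t)) (t ∷_) (toPair (suc k) l (subst (Vec ℕ) (+-suc k l) z , b))
toPair (suc k) (suc l) (t ∷ z , inj₂ b) =
  map (t ∷_) (bump t) (toPair k (suc l) (z , b))

fromPair : ∀ k l → Vec ℕ k × Vec ℕ l → Vec ℕ (k + l) × Box l k
fromPair zero    l       ([] , s)        = s , tt
fromPair (suc k) zero    (p , [])        = subst (Vec ℕ) (sym (+-identityʳ (suc k))) p , tt
fromPair (suc k) (suc l) (u ∷ p , v ∷ s) with u ≤? v
... | yes _ = map (u ∷_) inj₂ (fromPair k (suc l) (p , v ∸ u ∷ s))
... | no  _ = map (λ z → v ∷ subst (Vec ℕ) (sym (+-suc k l)) z) inj₁
                  (fromPair (suc k) l (u ∸ suc v ∷ p , s))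

fromPair-≤ : ∀ {k l u v} {p : Vec ℕ k} {s : Vec ℕ l} → u ≤ v →
  fromPair (suc k) (suc l) (u ∷ p , v ∷ s) ≡ map (u ∷_) inj₂ (fromPair k (suc l) (p , v ∸ u ∷ s))
fromPair-≤ {u = u} {v} u≤v with u ≤? v
... | yes _  = refl
... | no u≰v = contradiction u≤v u≰v

fromPair-> : ∀ {k l u v} {p : Vec ℕ k} {s : Vec ℕ l} → v < u →
  fromPair (suc k) (suc l) (u ∷ p , v ∷ s)
    ≡ map (λ z → v ∷ subst (Vec ℕ) (sym (+-suc k l)) z) inj₁
          (fromPair (suc k) l (u ∸ suc v ∷ p , s))
fromPair-> {u = u} {v} v<u with u ≤? v
... | yes u≤v = contradiction u≤v (<⇒≱ v<u)
... | no _    = refl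

toPair-fromPair : ∀ k l y → toPair k l (fromPair k l y) ≡ y
toPair-fromPair zero    l       ([] , s) = refl
toPair-fromPair (suc k) zero    (p , []) = cong (_, []) (subst-subst-sym (+-identityʳ (suc k)))
toPair-fromPair (suc k) (suc l) (u ∷ p , v ∷ s) with u ≤? v
... | yes u≤v = begin
  map (u ∷_) (bump u) (toPair k (suc l) (fromPair k (suc l) (p , v ∸ u ∷ s)))
    ≡⟨ cong (map (u ∷_) (bump u)) (toPair-fromPair k (suc l) (p , v ∸ u ∷ s)) ⟩
  u ∷ p , u + (v ∸ u) ∷ s
    ≡⟨ cong (λ w → u ∷ p , w ∷ s) (m+[n∸m]≡n u≤v) ⟩
  u ∷ p , v ∷ s ∎
... | no u≰v = begin
  map (bump (suc v)) (v ∷_)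
      (toPair (suc k) l (subst (Vec ℕ) (+-suc k l) (subst (Vec ℕ) (sym (+-suc k l)) z) , b))
    ≡⟨ cong (λ z′ → map (bump (suc v)) (v ∷_) (toPair (suc k) l (z′ , b)))
            (subst-subst-sym (+-suc k l)) ⟩
  map (bump (suc v)) (v ∷_) (toPair (suc k) l (fromPair (suc k) l (u ∸ suc v ∷ p , s)))
    ≡⟨ cong (map (bump (suc v)) (v ∷_)) (toPair-fromPair (suc k) l (u ∸ suc v ∷ p , s)) ⟩
  suc v + (u ∸ suc v) ∷ p , v ∷ s
    ≡⟨ cong (λ w → w ∷ p , v ∷ s) (m+[n∸m]≡n (≰⇒> u≰v)) ⟩
  u ∷ p , v ∷ s ∎
  where
  z = proj₁ (fromPair (suc k) l (u ∸ suc v ∷ p , s))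
  b = proj₂ (fromPair (suc k) l (u ∸ suc v ∷ p , s))

fromPair-toPair : ∀ k l y → fromPair k l (toPair k l y) ≡ y
fromPair-toPair zero    l       (z , tt) = refl
fromPair-toPair (suc k) zero    (z , tt) = cong (_, tt) (subst-sym-subst (+-identityʳ (suc k)))
fromPair-toPair (suc k) (suc l) (t ∷ z , inj₁ b) = begin
  fromPair (suc k) (suc l) (map (bump (suc t)) (t ∷_) r)
    ≡⟨ unbump r ⟩
  map cons-t inj₁ (fromPair (suc k) l r)
    ≡⟨ cong (map cons-t inj₁) (fromPair-toPair (suc k) l _) ⟩
  t ∷ subst (Vec ℕ) (sym (+-suc k l)) (subst (Vec ℕ) (+-suc k l) z) , inj₁ b
    ≡⟨ cong (λ z′ → t ∷ z′ , inj₁ b) (subst-sym-subst (+-suc k l)) ⟩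
  t ∷ z , inj₁ b ∎
  where
  r = toPair (suc k) l (subst (Vec ℕ) (+-suc k l) z , b)
  cons-t : Vec ℕ (suc k + l) → Vec ℕ (suc k + suc l)
  cons-t z′ = t ∷ subst (Vec ℕ) (sym (+-suc k l)) z′
  unbump : ∀ r → fromPair (suc k) (suc l) (map (bump (suc t)) (t ∷_) r)
                   ≡ map cons-t inj₁ (fromPair (suc k) l r)
  unbump (u ∷ p , s) = trans (fromPair-> (s≤s (m≤m+n t u)))
    (cong (λ w → map cons-t inj₁ (fromPair (suc k) l (w ∷ p , s))) (m+n∸m≡n (suc t) u))
fromPair-toPair (suc k) (suc l) (t ∷ z , inj₂ b) = begin
  fromPair (suc k) (suc l) (map (t ∷_) (bump t) (toPair k (suc l) (z , b)))
    ≡⟨ unbump (toPair k (suc l) (z , b)) ⟩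
  map (t ∷_) inj₂ (fromPair k (suc l) (toPair k (suc l) (z , b)))
    ≡⟨ cong (map (t ∷_) inj₂) (fromPair-toPair k (suc l) (z , b)) ⟩
  t ∷ z , inj₂ b ∎
  where
  unbump : ∀ r → fromPair (suc k) (suc l) (map (t ∷_) (bump t) r)
                   ≡ map (t ∷_) inj₂ (fromPair k (suc l) r)
  unbump (p , u ∷ s) = trans (fromPair-≤ (m≤m+n t u))
    (cong (λ w → map (t ∷_) inj₂ (fromPair k (suc l) (p , w ∷ s))) (m+n∸m≡n t u))

pairWeight-toPair : ∀ k l y → pairWeight (toPair k l y) ≡ coreWeight y
pairWeight-toPair zero    l       (z , _) = sym (+-identityʳ (weight z))
pairWeight-toPair (suc k) zero    (z , _) = cong (_+ 0) (weight-subst (+-identityʳ (suc k)) z)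
pairWeight-toPair (suc k) (suc l) (t ∷ z , inj₁ b) = begin
  weight (bump (suc t) p) + (suc l * t + weight s)
    ≡⟨ cong (_+ (suc l * t + weight s)) (weight-bump (suc t) p) ⟩
  suc k * suc t + weight p + (suc l * t + weight s)
    ≡⟨ shuffle k l t (weight p) (weight s) ⟩
  suc (k + suc l) * t + suc k + pairWeight (p , s)
    ≡⟨ cong (suc (k + suc l) * t + suc k +_) (pairWeight-toPair (suc k) l (z′ , b)) ⟩
  suc (k + suc l) * t + suc k + (weight z′ + boxWeight b)
    ≡⟨ cong (λ w → suc (k + suc l) * t + suc k + (w + boxWeight b)) (weight-subst (+-suc k l) z) ⟩
  suc (k + suc l) * t + suc k + (weight z + boxWeight b)
    ≡⟨ interchange (suc (k + suc l) * t) (suc k) (weight z) (boxWeight b) ⟩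
  suc (k + suc l) * t + weight z + (suc k + boxWeight b) ∎
  where
  z′ = subst (Vec ℕ) (+-suc k l) z
  p = proj₁ (toPair (suc k) l (z′ , b))
  s = proj₂ (toPair (suc k) l (z′ , b))
  shuffle : ∀ k l t P S → suc k * suc t + P + (suc l * t + S) ≡ suc (k + suc l) * t + suc k + (P + S)
  shuffle = solve-∀
  interchange : ∀ a b c d → a + b + (c + d) ≡ a + c + (b + d)
  interchange = solve-∀
pairWeight-toPair (suc k) (suc l) (t ∷ z , inj₂ b) = begin
  suc k * t + weight p + weight (bump t s)
    ≡⟨ cong (suc k * t + weight p +_) (weight-bump t s) ⟩
  suc k * t + weight p + (suc l * t + weight s)
    ≡⟨ shuffle k l t (weight p) (weight s) ⟩
  suc (k + suc l) * t + pairWeight (p , s)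
    ≡⟨ cong (suc (k + suc l) * t +_) (pairWeight-toPair k (suc l) (z , b)) ⟩
  suc (k + suc l) * t + (weight z + boxWeight b)
    ≡⟨ +-assoc (suc (k + suc l) * t) (weight z) (boxWeight b) ⟨
  suc (k + suc l) * t + weight z + boxWeight b ∎
  where
  p = proj₁ (toPair k (suc l) (z , b))
  s = proj₂ (toPair k (suc l) (z , b))
  shuffle : ∀ k l t P S → suc k * t + P + (suc l * t + S) ≡ suc (k + suc l) * t + (P + S)
  shuffle = solve-∀

-- Decreasing lists and their encodings

data Decreasing (lo : ℕ) : ℕ → List ℕ → Set where
  []   : ∀ {hi} → Decreasing lo hi []
  cons : ∀ {hi x xs} → lo ≤ x → x ≤ hi → Decreasing lo x xs → Decreasing lo hi (x ∷ xs)

widen-hi : ∀ {lo hi hi′ xs} → hi ≤ hi′ → Decreasing lo hi xs → Decreasing lo hi′ xs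
widen-hi h []              = []
widen-hi h (cons l u rest) = cons l (≤-trans u h) rest

narrow-hi : ∀ {lo hi c xs} → All (_≤ c) xs → Decreasing lo hi xs → Decreasing lo c xs
narrow-hi []        []              = []
narrow-hi (x≤c ∷ _) (cons l _ rest) = cons l x≤c rest

narrow-lo : ∀ {lo lo′ hi xs} → All (lo′ ≤_) xs → Decreasing lo hi xs → Decreasing lo′ hi xs
narrow-lo []       []              = []
narrow-lo (l ∷ ls) (cons _ u rest) = cons l u (narrow-lo ls rest)

Decreasing⇒All : ∀ {lo hi xs} {P : ℕ → Set} → (∀ {x} → lo ≤ x → x ≤ hi → P x) →
  Decreasing lo hi xs → All P xs
Decreasing⇒All f []              = []
Decreasing⇒All f (cons l u rest) =
  f l u ∷ Decreasing⇒All (λ l′ u′ → f l′ (≤-trans u′ u)) rest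

Decreasing⇒≥ : ∀ {lo hi xs} → Decreasing lo hi xs → All (lo ≤_) xs
Decreasing⇒≥ = Decreasing⇒All (λ l _ → l)

Decreasing⇒< : ∀ {lo hi xs} → Decreasing lo hi xs → All (_< suc hi) xs
Decreasing⇒< = Decreasing⇒All (λ _ u → s≤s u)

Decreasing-++ : ∀ {lo c hi xs ys} → lo ≤ c → c ≤ hi →
  Decreasing c hi xs → Decreasing lo c ys → Decreasing lo hi (xs ++ ys)
Decreasing-++ lo≤c c≤hi []              ys = widen-hi c≤hi ys
Decreasing-++ lo≤c c≤hi (cons l u rest) ys = cons (≤-trans lo≤c l) u (Decreasing-++ lo≤c l rest ys)

Decreasing-split : ∀ {lo hi} xs {y ys} → Decreasing lo hi (xs ++ y ∷ ys) →
  Decreasing y hi xs × Decreasing lo hi (y ∷ ys)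
Decreasing-split []       rest            = [] , rest
Decreasing-split (x ∷ xs) (cons l u rest) with above , cons l′ y≤x below ← Decreasing-split xs rest =
  cons y≤x u above , cons l′ (≤-trans y≤x u) below

Decreasing-replicate : ∀ n c → Decreasing c c (replicate n c)
Decreasing-replicate zero    c = []
Decreasing-replicate (suc n) c = cons ≤-refl ≤-refl (Decreasing-replicate n c)

Decreasing-constant : ∀ {c xs} → Decreasing c c xs → xs ≡ replicate (length xs) c
Decreasing-constant []              = refl
Decreasing-constant (cons l u rest) = cong₂ _∷_ (≤-antisym u l) (Decreasing-constant (widen-hi u rest))

takeWhile-++ : ∀ {c lo xs ys} → All (c <_) xs → Decreasing lo c ys → takeWhile (c <?_) (xs ++ ys) ≡ xs
takeWhile-++ {c} (c<x ∷ above) below rewrite dec-true (c <? _) c<x = cong (_ ∷_) (takeWhile-++ above below)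
takeWhile-++ {c} [] []                     = refl
takeWhile-++ {c} [] (cons {x = y} _ y≤c _) rewrite dec-false (c <? y) (≤⇒≯ y≤c) = refl

dropWhile-++ : ∀ {c lo xs ys} → All (c <_) xs → Decreasing lo c ys → dropWhile (c <?_) (xs ++ ys) ≡ ys
dropWhile-++ {c} (c<x ∷ above) below rewrite dec-true (c <? _) c<x = dropWhile-++ above below
dropWhile-++ {c} [] []                     = refl
dropWhile-++ {c} [] (cons {x = y} _ y≤c _) rewrite dec-false (c <? y) (≤⇒≯ y≤c) = refl

Decreasing-takeWhile : ∀ {c lo hi xs} → Decreasing lo hi xs → Decreasing (suc c) hi (takeWhile (c <?_) xs)
Decreasing-takeWhile []                          = []
Decreasing-takeWhile {c} (cons {x = x} l u rest) with c <? x
... | yes c<x rewrite dec-true  (c <? x) c<x = cons c<x u (Decreasing-takeWhile rest)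
... | no  c≮x rewrite dec-false (c <? x) c≮x = []

Decreasing-dropWhile : ∀ {c lo hi xs} → Decreasing lo hi xs → Decreasing lo c (dropWhile (c <?_) xs)
Decreasing-dropWhile []                          = []
Decreasing-dropWhile {c} (cons {x = x} l u rest) with c <? x
... | yes c<x rewrite dec-true  (c <? x) c<x = Decreasing-dropWhile rest
... | no  c≮x rewrite dec-false (c <? x) c≮x = cons l (≮⇒≥ c≮x) rest

sum-replicate : ∀ n c → sum (replicate n c) ≡ n * c
sum-replicate zero    c = refl
sum-replicate (suc n) c = cong (c +_) (sum-replicate n c)

-- The head of the vector is the excess of the smallest part over b, the rest are the differences
-- between consecutive parts, read upwards.
fromGaps : ∀ {N} → ℕ → Vec ℕ N → List ℕ
fromGaps b []      = []
fromGaps b (x ∷ v) = fromGaps (b + x) v ∷ʳ (b + x)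

ascendingGaps : ∀ N → ℕ → List ℕ → Vec ℕ N
ascendingGaps zero    b ys       = []
ascendingGaps (suc N) b []       = 0 ∷ ascendingGaps N b []
ascendingGaps (suc N) b (y ∷ ys) = y ∸ b ∷ ascendingGaps N y ys

toGaps : ∀ N → ℕ → List ℕ → Vec ℕ N
toGaps N b xs = ascendingGaps N b (reverse xs)

length-fromGaps : ∀ {N} b (v : Vec ℕ N) → length (fromGaps b v) ≡ N
length-fromGaps b []      = refl
length-fromGaps b (x ∷ v) =
  trans (length-++ (fromGaps (b + x) v)) (trans (+-comm _ 1) (cong suc (length-fromGaps (b + x) v)))

sum-fromGaps : ∀ {N} b (v : Vec ℕ N) → sum (fromGaps b v) ≡ N * b + weight v
sum-fromGaps b []              = refl
sum-fromGaps {suc N} b (x ∷ v) = begin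
  sum (fromGaps (b + x) v ∷ʳ (b + x))     ≡⟨ sum-++ (fromGaps (b + x) v) _ ⟩
  sum (fromGaps (b + x) v) + (b + x + 0)  ≡⟨ cong (_+ (b + x + 0)) (sum-fromGaps (b + x) v) ⟩
  N * (b + x) + weight v + (b + x + 0)    ≡⟨ shuffle N b x (weight v) ⟩
  suc N * b + (suc N * x + weight v)      ∎
  where
  shuffle : ∀ N b x W → N * (b + x) + W + (b + x + 0) ≡ suc N * b + (suc N * x + W)
  shuffle = solve-∀

Decreasing-fromGaps : ∀ {N} b (v : Vec ℕ N) → ∃[ hi ] Decreasing b hi (fromGaps b v)
Decreasing-fromGaps b []      = 0 , []
Decreasing-fromGaps b (x ∷ v) =
  let hi , rest = Decreasing-fromGaps (b + x) v in
  hi ⊔ (b + x) , Decreasing-++ (m≤m+n b x) (m≤n⊔m hi (b + x)) (widen-hi (m≤m⊔n hi (b + x)) rest)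
                               (cons (m≤m+n b x) ≤-refl [])

toGaps-fromGaps : ∀ {N} b (v : Vec ℕ N) → toGaps N b (fromGaps b v) ≡ v
toGaps-fromGaps b []      = refl
toGaps-fromGaps b (x ∷ v) = begin
  ascendingGaps _ b (reverse (fromGaps (b + x) v ∷ʳ (b + x)))
    ≡⟨ cong (ascendingGaps _ b) (reverse-++ (fromGaps (b + x) v) (b + x ∷ [])) ⟩
  b + x ∸ b ∷ toGaps _ (b + x) (fromGaps (b + x) v)
    ≡⟨ cong₂ _∷_ (m+n∸m≡n b x) (toGaps-fromGaps (b + x) v) ⟩
  x ∷ v ∎

fromGaps-ascendingGaps : ∀ {N b hi} ys → Decreasing b hi (reverse ys) → length ys ≡ N →
  fromGaps b (ascendingGaps N b ys) ≡ reverse ys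
fromGaps-ascendingGaps {zero}  []       _ _ = refl
fromGaps-ascendingGaps {suc N} {b} (y ∷ ys) dec len
  with above , cons b≤y _ _ ←
         Decreasing-split (reverse ys) (subst (Decreasing _ _) (unfold-reverse y ys) dec) =
  begin
    fromGaps (b + (y ∸ b)) (ascendingGaps N y ys) ∷ʳ (b + (y ∸ b))
      ≡⟨ cong (λ z → fromGaps z (ascendingGaps N y ys) ∷ʳ z) (m+[n∸m]≡n b≤y) ⟩
    fromGaps y (ascendingGaps N y ys) ∷ʳ y
      ≡⟨ cong (_∷ʳ y) (fromGaps-ascendingGaps ys above (suc-injective len)) ⟩
    reverse ys ∷ʳ y
      ≡⟨ unfold-reverse y ys ⟨
    reverse (y ∷ ys) ∎

fromGaps-toGaps : ∀ {N b hi} xs → Decreasing b hi xs → length xs ≡ N →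
  fromGaps b (toGaps N b xs) ≡ xs
fromGaps-toGaps xs dec len = trans
  (fromGaps-ascendingGaps (reverse xs) (subst (Decreasing _ _) (sym (reverse-involutive xs)) dec)
                          (trans (length-reverse xs) len))
  (reverse-involutive xs)

boxParts : ℕ → ∀ {l k} → Box l k → List ℕ
boxParts lo {l}     {zero}  _        = replicate l lo
boxParts lo {zero}  {suc k} _        = []
boxParts lo {suc l} {suc k} (inj₁ b) = lo + suc k ∷ boxParts lo b
boxParts lo {suc l} {suc k} (inj₂ b) = boxParts lo b

toBox : ℕ → ∀ l k → List ℕ → Box l k
toBox lo l       zero    xs       = tt
toBox lo zero    (suc k) xs       = tt
toBox lo (suc l) (suc k) []       = inj₂ (toBox lo (suc l) k [])
toBox lo (suc l) (suc k) (x ∷ xs) with x ≟ lo + suc k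
... | yes _ = inj₁ (toBox lo l (suc k) xs)
... | no  _ = inj₂ (toBox lo (suc l) k (x ∷ xs))

length-boxParts : ∀ lo {l k} (b : Box l k) → length (boxParts lo b) ≡ l
length-boxParts lo {l}     {zero}  _        = length-replicate l
length-boxParts lo {zero}  {suc k} _        = refl
length-boxParts lo {suc l} {suc k} (inj₁ b) = cong suc (length-boxParts lo b)
length-boxParts lo {suc l} {suc k} (inj₂ b) = length-boxParts lo b

sum-boxParts : ∀ lo {l k} (b : Box l k) → sum (boxParts lo b) ≡ l * lo + boxWeight b
sum-boxParts lo {l}     {zero}  _        = trans (sum-replicate l lo) (sym (+-identityʳ (l * lo)))
sum-boxParts lo {zero}  {suc k} _        = refl
sum-boxParts lo {suc l} {suc k} (inj₁ b) = begin
  lo + suc k + sum (boxParts lo b)     ≡⟨ cong (lo + suc k +_) (sum-boxParts lo b) ⟩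
  lo + suc k + (l * lo + boxWeight b)  ≡⟨ shuffle lo k l (boxWeight b) ⟩
  suc l * lo + (suc k + boxWeight b)   ∎
  where
  shuffle : ∀ lo k l W → lo + suc k + (l * lo + W) ≡ suc l * lo + (suc k + W)
  shuffle = solve-∀
sum-boxParts lo {suc l} {suc k} (inj₂ b) = sum-boxParts lo b

Decreasing-boxParts : ∀ lo {l k} (b : Box l k) → Decreasing lo (lo + k) (boxParts lo b)
Decreasing-boxParts lo {l}     {zero}  _        = widen-hi (m≤m+n lo 0) (Decreasing-replicate l lo)
Decreasing-boxParts lo {zero}  {suc k} _        = []
Decreasing-boxParts lo {suc l} {suc k} (inj₁ b) =
  cons (m≤m+n lo (suc k)) ≤-refl (Decreasing-boxParts lo b)
Decreasing-boxParts lo {suc l} {suc k} (inj₂ b) =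
  widen-hi (+-monoʳ-≤ lo (n≤1+n k)) (Decreasing-boxParts lo b)

toBox-below : ∀ {lo l k xs} → Decreasing lo (lo + k) xs →
  toBox lo (suc l) (suc k) xs ≡ inj₂ (toBox lo (suc l) k xs)
toBox-below                  []                    = refl
toBox-below {lo} {k = k} (cons {x = x} _ x≤ _) with x ≟ lo + suc k
... | yes x≡ = contradiction (≤-trans (≤-reflexive (sym (trans x≡ (+-suc lo k)))) x≤) 1+n≰n
... | no  _  = refl

toBox-boxParts : ∀ lo {l k} (b : Box l k) → toBox lo l k (boxParts lo b) ≡ b
toBox-boxParts lo {l}     {zero}  _        = refl
toBox-boxParts lo {zero}  {suc k} _        = refl
toBox-boxParts lo {suc l} {suc k} (inj₁ b) with lo + suc k ≟ lo + suc k
... | yes _   = cong inj₁ (toBox-boxParts lo b)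
... | no  x≢x = contradiction refl x≢x
toBox-boxParts lo {suc l} {suc k} (inj₂ b) =
  trans (toBox-below (Decreasing-boxParts lo b)) (cong inj₂ (toBox-boxParts lo b))

boxParts-toBox : ∀ lo l k {xs} → Decreasing lo (lo + k) xs → length xs ≡ l →
  boxParts lo (toBox lo l k xs) ≡ xs
boxParts-toBox lo l       zero    dec refl =
  sym (Decreasing-constant (widen-hi (≤-reflexive (+-identityʳ lo)) dec))
boxParts-toBox lo zero    (suc k) []  refl = refl
boxParts-toBox lo (suc l) (suc k) (cons {x = x} l≤x x≤ rest) len with x ≟ lo + suc k
... | yes refl = cong (x ∷_) (boxParts-toBox lo l (suc k) (widen-hi x≤ rest) (suc-injective len))
... | no  x≢   = boxParts-toBox lo (suc l) k
  (cons l≤x (≤-pred (≤-trans (≤∧≢⇒< x≤ x≢) (≤-reflexive (+-suc lo k)))) rest) len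

mult-cons-≡ : ∀ c xs → mult c (c ∷ xs) ≡ suc (mult c xs)
mult-cons-≡ c xs rewrite dec-true (c ≟ c) refl = refl

mult-cons-≢ : ∀ {c x} xs → x ≢ c → mult c (x ∷ xs) ≡ mult c xs
mult-cons-≢ {c} {x} xs x≢c rewrite dec-false (x ≟ c) x≢c = refl

mult-++ : ∀ c xs ys → mult c (xs ++ ys) ≡ mult c xs + mult c ys
mult-++ c []       ys = refl
mult-++ c (x ∷ xs) ys = trans (cong ((if x ≡ᵇ c then 1 else 0) +_) (mult-++ c xs ys))
                              (sym (+-assoc (if x ≡ᵇ c then 1 else 0) (mult c xs) (mult c ys)))

mult-replicate : ∀ c n → mult c (replicate n c) ≡ n
mult-replicate c zero    = refl
mult-replicate c (suc n) = trans (mult-cons-≡ c (replicate n c)) (cong suc (mult-replicate c n))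

mult-absent : ∀ {c xs} → All (_≢ c) xs → mult c xs ≡ 0
mult-absent                []           = refl
mult-absent {xs = x ∷ xs} (x≢c ∷ rest) = trans (mult-cons-≢ xs x≢c) (mult-absent rest)

mult-above : ∀ {c xs} → All (c <_) xs → mult c xs ≡ 0
mult-above above = mult-absent (All.map (λ c<x x≡c → <-irrefl (sym x≡c) c<x) above)

mult-below : ∀ {c lo hi xs} → hi < c → Decreasing lo hi xs → mult c xs ≡ 0
mult-below hi<c dec = mult-absent (Decreasing⇒All (λ _ x≤hi → <⇒≢ (≤-<-trans x≤hi hi<c)) dec)

fromMultiplicities : ∀ {k} → Vec ℕ k → List ℕ
fromMultiplicities []              = []
fromMultiplicities {suc k} (x ∷ v) = replicate x (suc k) ++ fromMultiplicities v

multiplicities : ∀ k → List ℕ → Vec ℕ k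
multiplicities zero    xs = []
multiplicities (suc k) xs = mult (suc k) xs ∷ multiplicities k xs

sum-fromMultiplicities : ∀ {k} (v : Vec ℕ k) → sum (fromMultiplicities v) ≡ weight v
sum-fromMultiplicities []              = refl
sum-fromMultiplicities {suc k} (x ∷ v) = begin
  sum (replicate x (suc k) ++ fromMultiplicities v)
    ≡⟨ sum-++ (replicate x (suc k)) _ ⟩
  sum (replicate x (suc k)) + sum (fromMultiplicities v)
    ≡⟨ cong₂ _+_ (sum-replicate x (suc k)) (sum-fromMultiplicities v) ⟩
  x * suc k + weight v
    ≡⟨ cong (_+ weight v) (*-comm x (suc k)) ⟩
  suc k * x + weight v ∎

Decreasing-fromMultiplicities : ∀ {k} (v : Vec ℕ k) → Decreasing 1 k (fromMultiplicities v)
Decreasing-fromMultiplicities []              = []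
Decreasing-fromMultiplicities {suc k} (x ∷ v) = Decreasing-++ (s≤s z≤n) ≤-refl
  (Decreasing-replicate x (suc k)) (widen-hi (n≤1+n k) (Decreasing-fromMultiplicities v))

multiplicities-++-above : ∀ k {xs} ys → All (k <_) xs →
  multiplicities k (xs ++ ys) ≡ multiplicities k ys
multiplicities-++-above zero    ys above = refl
multiplicities-++-above (suc k) {xs} ys above = cong₂ _∷_
  (begin
    mult (suc k) (xs ++ ys)            ≡⟨ mult-++ (suc k) xs ys ⟩
    mult (suc k) xs + mult (suc k) ys  ≡⟨ cong (_+ mult (suc k) ys) (mult-above above) ⟩
    mult (suc k) ys                    ∎)
  (multiplicities-++-above k ys (All.map <⇒≤ above))

multiplicities-fromMultiplicities : ∀ {k} (v : Vec ℕ k) → multiplicities k (fromMultiplicities v) ≡ v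
multiplicities-fromMultiplicities []              = refl
multiplicities-fromMultiplicities {suc k} (x ∷ v) = cong₂ _∷_
  (begin
    mult (suc k) (replicate x (suc k) ++ rest)
      ≡⟨ mult-++ (suc k) (replicate x (suc k)) rest ⟩
    mult (suc k) (replicate x (suc k)) + mult (suc k) rest
      ≡⟨ cong₂ _+_ (mult-replicate (suc k) x) (mult-below ≤-refl (Decreasing-fromMultiplicities v)) ⟩
    x + 0
      ≡⟨ +-identityʳ x ⟩
    x ∎)
  (trans (multiplicities-++-above k rest (replicate⁺ x ≤-refl)) (multiplicities-fromMultiplicities v))
  where
  rest = fromMultiplicities v

peel-largest : ∀ {lo} k xs → Decreasing lo (suc k) xs →
  ∃[ ys ] xs ≡ replicate (mult (suc k) xs) (suc k) ++ ys × Decreasing lo k ys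
peel-largest k []       []               = [] , refl , []
peel-largest k (x ∷ xs) (cons l x≤ rest) with x ≟ suc k
... | yes refl rewrite mult-cons-≡ (suc k) xs with ys , xs≡ , dec ← peel-largest k xs rest =
  ys , cong (suc k ∷_) xs≡ , dec
... | no x≢ = x ∷ xs , cong (λ c → replicate c (suc k) ++ x ∷ xs) (sym (mult-below ≤-refl dec)) , dec
  where
  x≤k : x ≤ k
  x≤k = ≤-pred (≤∧≢⇒< x≤ x≢)
  dec : Decreasing _ k (x ∷ xs)
  dec = cons l x≤k rest

fromMultiplicities-multiplicities : ∀ k {xs} → Decreasing 1 k xs →
  fromMultiplicities (multiplicities k xs) ≡ xs
fromMultiplicities-multiplicities zero    []               = refl
fromMultiplicities-multiplicities zero    (cons 1≤x x≤0 _) = contradiction (≤-trans 1≤x x≤0) λ ()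
fromMultiplicities-multiplicities (suc k) {xs} dec with ys , xs≡ , ys-dec ← peel-largest k xs dec = begin
  replicate c (suc k) ++ fromMultiplicities (multiplicities k xs)
    ≡⟨ cong (λ zs → replicate c (suc k) ++ fromMultiplicities (multiplicities k zs)) xs≡ ⟩
  replicate c (suc k) ++ fromMultiplicities (multiplicities k (replicate c (suc k) ++ ys))
    ≡⟨ cong (λ v → replicate c (suc k) ++ fromMultiplicities v)
            (multiplicities-++-above k ys (replicate⁺ c ≤-refl)) ⟩
  replicate c (suc k) ++ fromMultiplicities (multiplicities k ys)
    ≡⟨ cong (replicate c (suc k) ++_) (fromMultiplicities-multiplicities k ys-dec) ⟩
  replicate c (suc k) ++ ys
    ≡⟨ xs≡ ⟨
  xs ∎
  where
  c = mult (suc k) xs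

-- The Boolean predicates of the statement

∧-intro : ∀ {a b} → T a → T b → T (a ∧ b)
∧-intro p q = Equivalence.from T-∧ (p , q)

∧-elim : ∀ {a b} → T (a ∧ b) → T a × T b
∧-elim = Equivalence.to T-∧

Decreasing⇒isPartitionOf : ∀ {hi xs} → Decreasing 1 hi xs → T (isPartitionOf (sum xs) xs)
Decreasing⇒isPartitionOf {xs = xs} dec =
  ∧-intro (positive dec) (∧-intro (ordered dec) (≡⇒≡ᵇ (sum xs) (sum xs) refl))
  where
  positive : ∀ {hi xs} → Decreasing 1 hi xs → T (allPos xs)
  positive []              = tt
  positive (cons l _ rest) = ∧-intro (≤⇒≤ᵇ l) (positive rest)
  ordered : ∀ {hi xs} → Decreasing 1 hi xs → T (decreasing xs)
  ordered []                           = tt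
  ordered (cons _ _ [])                = tt
  ordered (cons _ _ rest@(cons _ u _)) = ∧-intro (≤⇒≤ᵇ u) (ordered rest)

isPartitionOf⇒Decreasing : ∀ {n} xs → T (isPartitionOf n xs) → ∃[ hi ] Decreasing 1 hi xs
isPartitionOf⇒Decreasing []       _ = 0 , []
isPartitionOf⇒Decreasing (x ∷ xs) p =
  let pos , rest = ∧-elim p in x , fromBool x xs ≤-refl pos (proj₁ (∧-elim rest))
  where
  fromBool : ∀ {hi} x xs → x ≤ hi → T (allPos (x ∷ xs)) → T (decreasing (x ∷ xs)) →
             Decreasing 1 hi (x ∷ xs)
  fromBool x []       x≤hi pos _   = cons (≤ᵇ⇒≤ 1 x (proj₁ (∧-elim pos))) x≤hi []
  fromBool x (y ∷ ys) x≤hi pos ord =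
    let 1≤x , pos′ = ∧-elim pos ; y≤x , ord′ = ∧-elim ord in
    cons (≤ᵇ⇒≤ 1 x 1≤x) x≤hi (fromBool y ys (≤ᵇ⇒≤ y x y≤x) pos′ ord′)

isPartitionOf⇒sum : ∀ {n} xs → T (isPartitionOf n xs) → sum xs ≡ n
isPartitionOf⇒sum {n} xs p =
  ≡ᵇ⇒≡ (sum xs) n (proj₂ (∧-elim {decreasing xs} (proj₂ (∧-elim {allPos xs} p))))

Decreasing⇒partsBelow : ∀ {lo m′ xs} → Decreasing lo m′ xs → T (partsBelow (suc m′) xs)
Decreasing⇒partsBelow []              = tt
Decreasing⇒partsBelow (cons _ u rest) =
  ∧-intro (<⇒<ᵇ (s≤s u)) (Decreasing⇒partsBelow (widen-hi u rest))

partsBelow⇒All : ∀ {m} xs → T (partsBelow m xs) → All (_< m) xs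
partsBelow⇒All     []       _ = []
partsBelow⇒All {m} (x ∷ xs) p = let x<m , rest = ∧-elim p in <ᵇ⇒< x m x<m ∷ partsBelow⇒All xs rest

SecondColour : ℕ → List ℕ → Set
SecondColour m ν = T (isPartitionOf (sum ν) ν ∧ partsBelow m ν)

Decreasing⇒SecondColour : ∀ {m′ ν} → Decreasing 1 m′ ν → SecondColour (suc m′) ν
Decreasing⇒SecondColour dec = ∧-intro (Decreasing⇒isPartitionOf dec) (Decreasing⇒partsBelow dec)

SecondColour⇒Decreasing : ∀ {m′} ν → SecondColour (suc m′) ν → Decreasing 1 m′ ν
SecondColour⇒Decreasing ν snd = let part , below = ∧-elim {isPartitionOf (sum ν) ν} snd in
  narrow-hi (All.map ≤-pred (partsBelow⇒All ν below)) (proj₂ (isPartitionOf⇒Decreasing ν part))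

OutsideGap : ℕ → ℕ → ℕ → Set
OutsideGap L K x = x ≤ L ⊎ L + K < x

absent⇒¬isPart : ∀ {v} xs → All (_≢ v) xs → T (not (isPart v xs))
absent⇒¬isPart     []       []           = tt
absent⇒¬isPart {v} (x ∷ xs) (x≢v ∷ rest) with x ≡ᵇ v in eq
... | false = absent⇒¬isPart xs rest
... | true  = x≢v (≡ᵇ⇒≡ x v (subst T (sym eq) tt))

¬isPart⇒absent : ∀ {v} xs → T (not (isPart v xs)) → All (_≢ v) xs
¬isPart⇒absent     []       _ = []
¬isPart⇒absent {v} (x ∷ xs) p with x ≡ᵇ v in eq
... | false = (λ x≡v → subst T eq (≡⇒≡ᵇ x v x≡v)) ∷ ¬isPart⇒absent xs p

All⇒noPartsIn : ∀ L K {xs} → All (OutsideGap L K) xs → T (noPartsIn L K xs)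
All⇒noPartsIn L zero    _   = tt
All⇒noPartsIn L (suc K) out =
  ∧-intro (absent⇒¬isPart _ (All.map notEdge out)) (All⇒noPartsIn L K (All.map narrow out))
  where
  notEdge : ∀ {x} → OutsideGap L (suc K) x → x ≢ L + suc K
  notEdge (inj₁ x≤L)   refl = m+1+n≰m L x≤L
  notEdge (inj₂ gap<x) refl = <-irrefl refl gap<x
  narrow : ∀ {x} → OutsideGap L (suc K) x → OutsideGap L K x
  narrow (inj₁ x≤L)   = inj₁ x≤L
  narrow (inj₂ gap<x) = inj₂ (<-trans (+-monoʳ-< L (n<1+n K)) gap<x)

noPartsIn⇒All : ∀ L K {xs} → T (noPartsIn L K xs) → All (OutsideGap L K) xs
noPartsIn⇒All L zero {xs} _ = All.universal outside xs
  where
  outside : ∀ x → OutsideGap L 0 x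
  outside x with x ≤? L
  ... | yes x≤L = inj₁ x≤L
  ... | no  x≰L = inj₂ (subst (_< x) (sym (+-identityʳ L)) (≰⇒> x≰L))
noPartsIn⇒All L (suc K) {xs} p =
  let absent , rest = ∧-elim {not (isPart (L + suc K) xs)} p in
  All.zipWith widen (¬isPart⇒absent xs absent , noPartsIn⇒All L K rest)
  where
  widen : ∀ {x} → x ≢ L + suc K × OutsideGap L K x → OutsideGap L (suc K) x
  widen     (_  , inj₁ x≤L)   = inj₁ x≤L
  widen {x} (x≢ , inj₂ gap<x) =
    inj₂ (≤∧≢⇒< (subst (_≤ x) (sym (+-suc L K)) gap<x) (x≢ ∘ sym))

Σ-≡-irrelevant : ∀ {A : Set} {P : A → Set} → (∀ {a} → Irrelevant (P a)) →
  {x y : Σ A P} → proj₁ x ≡ proj₁ y → x ≡ y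
Σ-≡-irrelevant irr {a , p} {.a , q} refl = cong (a ,_) (irr p q)

-- Conjugates and fixed hooks

conj-cons-≥ : ∀ {j x} xs → j ≤ x → conj (x ∷ xs) j ≡ suc (conj xs j)
conj-cons-≥ {j} {x} xs j≤x rewrite dec-true (j ≤? x) j≤x = refl

conj-cons-< : ∀ {j x} xs → x < j → conj (x ∷ xs) j ≡ conj xs j
conj-cons-< {j} {x} xs x<j rewrite dec-false (j ≤? x) (<⇒≱ x<j) = refl

conj-++ : ∀ xs ys j → conj (xs ++ ys) j ≡ conj xs j + conj ys j
conj-++ []       ys j = refl
conj-++ (x ∷ xs) ys j = trans (cong ((if j ≤ᵇ x then 1 else 0) +_) (conj-++ xs ys j))
                              (sym (+-assoc (if j ≤ᵇ x then 1 else 0) (conj xs j) (conj ys j)))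

conj-all-≥ : ∀ {j xs} → All (j ≤_) xs → conj xs j ≡ length xs
conj-all-≥                []           = refl
conj-all-≥ {xs = x ∷ xs} (j≤x ∷ rest) = trans (conj-cons-≥ xs j≤x) (cong suc (conj-all-≥ rest))

conj-all-< : ∀ {j xs} → All (_< j) xs → conj xs j ≡ 0
conj-all-<                []           = refl
conj-all-< {xs = x ∷ xs} (x<j ∷ rest) = trans (conj-cons-< xs x<j) (conj-all-< rest)

conj-rows : ∀ {j r} a σ ν → All (j ≤_) a → j ≤ r → All (j ≤_) σ → All (_< j) ν →
  conj (a ++ r ∷ σ ++ ν) j ≡ length a + suc (length σ)
conj-rows {j} {r} a σ ν a≥ r≥ σ≥ ν< = begin
  conj (a ++ r ∷ σ ++ ν) j        ≡⟨ cong (λ xs → conj xs j) (++-assoc a (r ∷ σ) ν) ⟨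
  conj ((a ++ r ∷ σ) ++ ν) j      ≡⟨ conj-++ (a ++ r ∷ σ) ν j ⟩
  conj (a ++ r ∷ σ) j + conj ν j
    ≡⟨ cong₂ _+_ (conj-all-≥ (++⁺ a≥ (r≥ ∷ σ≥))) (conj-all-< ν<) ⟩
  length (a ++ r ∷ σ) + 0         ≡⟨ +-identityʳ _ ⟩
  length (a ++ r ∷ σ)             ≡⟨ length-++ a ⟩
  length a + suc (length σ)       ∎

-- Row j, of length r, has a fixed hook in column m when λ'_m = c: h_{j,m} = j with the
-- subtraction in the hook length moved across, as in zfhFrom.
IsFixedHook : ℕ → ℕ → ℕ → ℕ → Set
IsFixedHook m c j r = r + c + 1 ≡ j + j + m

fixedHook⇔rowsAbove : ∀ m k a d → IsFixedHook m (a + suc d) (suc a) (m + k) ⇔ a ≡ k + d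
fixedHook⇔rowsAbove m k a d = mk⇔ to from
  where
  to : IsFixedHook m (a + suc d) (suc a) (m + k) → a ≡ k + d
  to fixed = +-cancelˡ-≡ (suc (suc (a + m))) a (k + d) (begin
    suc (suc (a + m)) + a       ≡⟨ shape₁ a m ⟩
    suc a + suc a + m           ≡⟨ fixed ⟨
    m + k + (a + suc d) + 1     ≡⟨ shape₂ m k d a ⟩
    suc (suc (a + m)) + (k + d) ∎)
    where
    shape₁ : ∀ a m → suc (suc (a + m)) + a ≡ suc a + suc a + m
    shape₁ = solve-∀
    shape₂ : ∀ m k d a → m + k + (a + suc d) + 1 ≡ suc (suc (a + m)) + (k + d)
    shape₂ = solve-∀
  from : a ≡ k + d → IsFixedHook m (a + suc d) (suc a) (m + k)
  from refl = shape m k d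
    where
    shape : ∀ m k d → m + k + (k + d + suc d) + 1 ≡ suc (k + d) + suc (k + d) + m
    shape = solve-∀

-- A row with a fixed hook among the rows ys, which start at index i in a partition with λ'_m = c.
record FixedHookRow (m c i : ℕ) (ys : List ℕ) : Set where
  constructor fixedAt
  field
    above : List ℕ
    row   : ℕ
    below : List ℕ
    split : ys ≡ above ++ row ∷ below
    long  : m ≤ row
    fixed : IsFixedHook m c (i + length above) row

  parts : List ℕ × ℕ × List ℕ
  parts = above , row , below

fixedHookRow : ∀ {m full} i ys → T (zfhFrom i ys m full) → FixedHookRow m (conj full m) i ys
fixedHookRow {m} i (x ∷ xs) p with Equivalence.to T-∨ p
... | inj₁ here = let m≤x , eq = ∧-elim here in
  fixedAt [] x xs refl (≤ᵇ⇒≤ m x m≤x)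
    (trans (≡ᵇ⇒≡ _ _ eq) (cong (λ j → j + j + m) (sym (+-identityʳ i))))
... | inj₂ later with fixedAt a r b refl long fixed ← fixedHookRow (suc i) xs later =
  fixedAt (x ∷ a) r b refl long (trans fixed (cong (λ j → j + j + m) (sym (+-suc i (length a)))))

FixedHookRow⇒zfhFrom : ∀ {m full i ys} → FixedHookRow m (conj full m) i ys → T (zfhFrom i ys m full)
FixedHookRow⇒zfhFrom {m} {i = i} (fixedAt [] r b refl long fixed) =
  Equivalence.from T-∨ (inj₁ (∧-intro
    (≤⇒≤ᵇ long) (≡⇒≡ᵇ _ _ (trans fixed (cong (λ j → j + j + m) (+-identityʳ i))))))
FixedHookRow⇒zfhFrom {m} {i = i} (fixedAt (y ∷ a) r b refl long fixed) =
  Equivalence.from T-∨ (inj₂ (FixedHookRow⇒zfhFrom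
    (fixedAt a r b refl long (trans fixed (cong (λ j → j + j + m) (+-suc i (length a)))))))

-- λ_j − 2j strictly decreases down a partition, so at most one row has a fixed hook.
no-two-fixedHooks : ∀ {m c j j′ r r′} → j < j′ → r′ ≤ r →
  IsFixedHook m c j r → IsFixedHook m c j′ r′ → ⊥
no-two-fixedHooks {m} {c} j<j′ r′≤r fixed fixed′ =
  <⇒≱ (+-monoˡ-< m (+-mono-< j<j′ j<j′))
      (subst₂ _≤_ fixed′ fixed (+-monoˡ-≤ 1 (+-monoˡ-≤ c r′≤r)))

fixedRow-unique : ∀ {m c lo hi} i a {r b} a′ {r′ b′} → Decreasing lo hi (a ++ r ∷ b) →
  a ++ r ∷ b ≡ a′ ++ r′ ∷ b′ →
  IsFixedHook m c (i + length a) r → IsFixedHook m c (i + length a′) r′ → a ≡ a′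
fixedRow-unique i []      []        _                e f f′ = refl
fixedRow-unique i []      (y′ ∷ a′) (cons _ _ below) e f f′
  with _ , cons _ r′≤r _ ← Decreasing-split a′ (subst (Decreasing _ _) (∷-injectiveʳ e) below) =
  ⊥-elim (no-two-fixedHooks (+-monoʳ-< i (s≤s z≤n)) r′≤r f f′)
fixedRow-unique i (y ∷ a) []        dec              e f f′
  with cons _ _ below ← subst (Decreasing _ _) e dec
  with _ , cons _ r≤r′ _ ← Decreasing-split a (subst (Decreasing _ _) (sym (∷-injectiveʳ e)) below) =
  ⊥-elim (no-two-fixedHooks (+-monoʳ-< i (s≤s z≤n)) r≤r′ f′ f)
fixedRow-unique {m} {c} i (y ∷ a) {r} (y′ ∷ a′) {r′} (cons _ _ below) e f f′ =
  cong₂ _∷_ (∷-injectiveˡ e)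
    (fixedRow-unique (suc i) a a′ below (∷-injectiveʳ e) (shift r a f) (shift r′ a′ f′))
  where
  shift : ∀ r a → IsFixedHook m c (i + suc (length a)) r → IsFixedHook m c (suc i + length a) r
  shift r a f = trans f (cong (λ j → j + j + m) (+-suc i (length a)))

FixedHookRow-unique : ∀ {m c i lo hi ys} → Decreasing lo hi ys → (h h′ : FixedHookRow m c i ys) →
  FixedHookRow.parts h ≡ FixedHookRow.parts h′
FixedHookRow-unique {m} {i = i} dec (fixedAt a r b refl _ f) (fixedAt a′ r′ b′ e _ f′)
  with refl ← fixedRow-unique {m} i a a′ dec e f f′
  with refl , refl ← ∷-injective (++-cancelˡ a _ _ e) = refl

-- The bijection, for a fixed column m = m′ + 1

module Column (m′ : ℕ) where

  m : ℕ
  m = suc m′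

  Free : (ℕ → ℕ → Set) → Set
  Free C = Σ ℕ λ k → Σ ℕ λ d → C k d × List ℕ

  -- The size of the smallest partition with parameters k and d, on either side.
  baseSize : ℕ → ℕ → ℕ
  baseSize k d = (k + d) * (m + k) + (m + k) + d * m

  size : ∀ {C} → (∀ {k d : ℕ} → C k d → ℕ) → Free C → ℕ
  size w (k , d , c , ν) = baseSize k d + w c + sum ν

  InFiber : ∀ {C} → (∀ {k d : ℕ} → C k d → ℕ) → ℕ → Free C → Set
  InFiber w n f = SecondColour m (proj₂ (proj₂ (proj₂ f))) × size w f ≡ n

  Fiber : (C : ℕ → ℕ → Set) → (∀ {k d : ℕ} → C k d → ℕ) → ℕ → Set
  Fiber C w n = Σ (Free C) (InFiber w n)

  Fiber-≡ : ∀ {C} {w : ∀ {k d : ℕ} → C k d → ℕ} {n} {x y : Fiber C w n} →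
    proj₁ x ≡ proj₁ y → x ≡ y
  Fiber-≡ = Σ-≡-irrelevant λ (s , e) (s′ , e′) →
    cong₂ _,_ (T-irrelevant s s′) (≡-irrelevant e e′)

  HookCore PairCore : ℕ → ℕ → Set
  HookCore k d = Vec ℕ (k + d) × Box d k
  PairCore k d = Vec ℕ k × Vec ℕ d

  fiber-hook↔pair : ∀ n → Fiber HookCore coreWeight n ↔ Fiber PairCore pairWeight n
  fiber-hook↔pair n = mk↔ₛ′ to from to∘from from∘to
    where
    to : Fiber HookCore coreWeight n → Fiber PairCore pairWeight n
    to ((k , d , c , ν) , s , e) =
      (k , d , toPair k d c , ν) , s ,
      trans (cong (λ w → baseSize k d + w + sum ν) (pairWeight-toPair k d c)) e
    from : Fiber PairCore pairWeight n → Fiber HookCore coreWeight n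
    from ((k , d , c , ν) , s , e) =
      (k , d , fromPair k d c , ν) , s , trans (cong (λ w → baseSize k d + w + sum ν) w≡) e
      where
      w≡ : coreWeight (fromPair k d c) ≡ pairWeight c
      w≡ = trans (sym (pairWeight-toPair k d (fromPair k d c))) (cong pairWeight (toPair-fromPair k d c))
    to∘from : ∀ x → to (from x) ≡ x
    to∘from ((k , d , c , ν) , _) = Fiber-≡ (cong (λ c → k , d , c , ν) (toPair-fromPair k d c))
    from∘to : ∀ x → from (to x) ≡ x
    from∘to ((k , d , c , ν) , _) = Fiber-≡ (cong (λ c → k , d , c , ν) (fromPair-toPair k d c))

  hookPartition : Free HookCore → List ℕ
  hookPartition (k , d , (t , b) , ν) = fromGaps (m + k) t ++ m + k ∷ boxParts m b ++ ν

  Decreasing-hookPartition : ∀ k d t b {ν} → Decreasing 1 m′ ν →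
    ∃[ hi ] Decreasing 1 hi (hookPartition (k , d , (t , b) , ν))
  Decreasing-hookPartition k d t b ν-dec =
    let hi , above = Decreasing-fromGaps (m + k) t in
    hi ⊔ (m + k) , Decreasing-++ (s≤s z≤n) (m≤n⊔m hi (m + k)) (widen-hi (m≤m⊔n hi (m + k)) above)
      (cons (s≤s z≤n) ≤-refl
        (Decreasing-++ (s≤s z≤n) (m≤m+n m k) (Decreasing-boxParts m b) (widen-hi (n≤1+n m′) ν-dec)))

  sum-hookPartition : ∀ f → sum (hookPartition f) ≡ size coreWeight f
  sum-hookPartition (k , d , (t , b) , ν) = begin
    sum (fromGaps (m + k) t ++ m + k ∷ boxParts m b ++ ν)
      ≡⟨ sum-++ (fromGaps (m + k) t) _ ⟩
    sum (fromGaps (m + k) t) + (m + k + sum (boxParts m b ++ ν))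
      ≡⟨ cong₂ (λ x y → x + (m + k + y)) (sum-fromGaps (m + k) t)
               (trans (sum-++ (boxParts m b) ν) (cong (_+ sum ν) (sum-boxParts m b))) ⟩
    (k + d) * (m + k) + weight t + (m + k + (d * m + boxWeight b + sum ν))
      ≡⟨ shuffle ((k + d) * (m + k)) (weight t) (m + k) (d * m) (boxWeight b) (sum ν) ⟩
    baseSize k d + (weight t + boxWeight b) + sum ν ∎
    where
    shuffle : ∀ A T M D B V → A + T + (M + (D + B + V)) ≡ A + M + D + (T + B) + V
    shuffle = solve-∀

  hookPartition-fixedHookRow : ∀ k d t b {ν} → Decreasing 1 m′ ν →
    let lam = hookPartition (k , d , (t , b) , ν) in FixedHookRow m (conj lam m) 1 lam
  hookPartition-fixedHookRow k d t b {ν} ν-dec = fixedAt above (m + k) (boxParts m b ++ ν) refl (m≤m+n m k)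
    (subst (λ c → IsFixedHook m c (suc (length above)) (m + k)) (sym conj≡)
           (Equivalence.from (fixedHook⇔rowsAbove m k (length above) (length (boxParts m b))) rowsAbove))
    where
    above = fromGaps (m + k) t
    conj≡ : conj (hookPartition (k , d , (t , b) , ν)) m ≡ length above + suc (length (boxParts m b))
    conj≡ = conj-rows above (boxParts m b) ν
      (All.map (≤-trans (m≤m+n m k)) (Decreasing⇒≥ (proj₂ (Decreasing-fromGaps (m + k) t))))
      (m≤m+n m k) (Decreasing⇒≥ (Decreasing-boxParts m b)) (Decreasing⇒< ν-dec)
    rowsAbove : length above ≡ k + length (boxParts m b)
    rowsAbove = trans (length-fromGaps (m + k) t) (cong (k +_) (sym (length-boxParts m b)))

  hookCoordinatesWith : ℕ → ℕ → List ℕ × ℕ × List ℕ → Free HookCore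
  hookCoordinatesWith k d (a , _ , b) =
    k , d , (toGaps (k + d) (m + k) a , toBox m d k (takeWhile (m′ <?_) b)) , dropWhile (m′ <?_) b

  hookCoordinates : List ℕ × ℕ × List ℕ → Free HookCore
  hookCoordinates (a , r , b) = hookCoordinatesWith (r ∸ m) (length (takeWhile (m′ <?_) b)) (a , r , b)

  hookCoordinates-hookPartition : ∀ k d t b {ν} → Decreasing 1 m′ ν →
    hookCoordinates (fromGaps (m + k) t , m + k , boxParts m b ++ ν) ≡ (k , d , (t , b) , ν)
  hookCoordinates-hookPartition k d t b {ν} ν-dec = begin
    hookCoordinatesWith (m + k ∸ m) (length (takeWhile (m′ <?_) rest)) parts
      ≡⟨ cong₂ (λ k′ d′ → hookCoordinatesWith k′ d′ parts) (m+n∸m≡n m k)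
               (trans (cong length top≡) (length-boxParts m b)) ⟩
    k , d , (toGaps (k + d) (m + k) (fromGaps (m + k) t) , toBox m d k (takeWhile (m′ <?_) rest)) ,
      dropWhile (m′ <?_) rest
      ≡⟨ cong₂ (λ t′ bν → k , d , (t′ , proj₁ bν) , proj₂ bν) (toGaps-fromGaps (m + k) t)
               (cong₂ _,_ (trans (cong (toBox m d k) top≡) (toBox-boxParts m b))
                          (dropWhile-++ top ν-dec)) ⟩
    k , d , (t , b) , ν ∎
    where
    rest = boxParts m b ++ ν
    parts = fromGaps (m + k) t , m + k , rest
    top : All (m′ <_) (boxParts m b)
    top = Decreasing⇒≥ (Decreasing-boxParts m b)
    top≡ : takeWhile (m′ <?_) rest ≡ boxParts m b
    top≡ = takeWhile-++ top ν-dec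

  module _ {hi lam} (dec : Decreasing 1 hi lam) (h : FixedHookRow m (conj lam m) 1 lam) where
    open FixedHookRow h

    private
      σ = takeWhile (m′ <?_) below
      ν = dropWhile (m′ <?_) below
      k = row ∸ m
      d = length σ
      row≡ : m + k ≡ row
      row≡ = m+[n∸m]≡n long
      cut = Decreasing-split above (subst (Decreasing 1 hi) split dec)
      above-dec : Decreasing row hi above
      above-dec = proj₁ cut
      below-dec : Decreasing 1 row below
      below-dec with cons _ _ rest ← proj₂ cut = rest
      σ-dec : Decreasing m row σ
      σ-dec = Decreasing-takeWhile below-dec

    Decreasing-hookCoordinates-colours : Decreasing 1 m′ ν
    Decreasing-hookCoordinates-colours = Decreasing-dropWhile below-dec

    private
      rowsAbove : length above ≡ k + d
      rowsAbove = Equivalence.to (fixedHook⇔rowsAbove m k (length above) d)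
        (subst₂ (λ c r → IsFixedHook m c (suc (length above)) r) conj≡ (sym row≡) fixed)
        where
        conj≡ : conj lam m ≡ length above + suc d
        conj≡ = begin
          conj lam m                    ≡⟨ cong (λ xs → conj xs m) split ⟩
          conj (above ++ row ∷ below) m
            ≡⟨ cong (λ b → conj (above ++ row ∷ b) m) (takeWhile++dropWhile (m′ <?_) below) ⟨
          conj (above ++ row ∷ σ ++ ν) m
            ≡⟨ conj-rows above σ ν (All.map (≤-trans long) (Decreasing⇒≥ above-dec)) long
                         (Decreasing⇒≥ σ-dec) (Decreasing⇒< Decreasing-hookCoordinates-colours) ⟩
          length above + suc d          ∎

    hookPartition-hookCoordinates : hookPartition (hookCoordinates parts) ≡ lam
    hookPartition-hookCoordinates = begin
      fromGaps (m + k) (toGaps (k + d) (m + k) above) ++ m + k ∷ boxParts m (toBox m d k σ) ++ ν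
        ≡⟨ cong₂ (λ a r → a ++ r ∷ boxParts m (toBox m d k σ) ++ ν) above≡ row≡ ⟩
      above ++ row ∷ boxParts m (toBox m d k σ) ++ ν
        ≡⟨ cong (λ s → above ++ row ∷ s ++ ν) σ≡ ⟩
      above ++ row ∷ σ ++ ν
        ≡⟨ cong (λ b → above ++ row ∷ b) (takeWhile++dropWhile (m′ <?_) below) ⟩
      above ++ row ∷ below
        ≡⟨ split ⟨
      lam ∎
      where
      above≡ : fromGaps (m + k) (toGaps (k + d) (m + k) above) ≡ above
      above≡ = fromGaps-toGaps above (subst (λ r → Decreasing r hi above) (sym row≡) above-dec) rowsAbove
      σ≡ : boxParts m (toBox m d k σ) ≡ σ
      σ≡ = boxParts-toBox m d k (subst (λ r → Decreasing m r σ) (sym row≡) σ-dec) refl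

  lhs↔fiber : ∀ n → LHS m n ↔ Fiber HookCore coreWeight n
  lhs↔fiber n = mk↔ₛ′ encode decode encode∘decode decode∘encode
    where
    Condition : List ℕ → Set
    Condition lam = T (isPartitionOf n lam ∧ hasZeroFixedHook m lam)

    ordered : ∀ lam → Condition lam → ∃[ hi ] Decreasing 1 hi lam
    ordered lam v = isPartitionOf⇒Decreasing lam (proj₁ (∧-elim {isPartitionOf n lam} v))

    hook : ∀ lam → Condition lam → FixedHookRow m (conj lam m) 1 lam
    hook lam v = fixedHookRow 1 lam (proj₂ (∧-elim {isPartitionOf n lam} v))

    encode : LHS m n → Fiber HookCore coreWeight n
    encode (lam , v) = f , Decreasing⇒SecondColour (Decreasing-hookCoordinates-colours dec h) , (begin
      size coreWeight f   ≡⟨ sum-hookPartition f ⟨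
      sum (hookPartition f) ≡⟨ cong sum (hookPartition-hookCoordinates dec h) ⟩
      sum lam             ≡⟨ isPartitionOf⇒sum lam (proj₁ (∧-elim {isPartitionOf n lam} v)) ⟩
      n                   ∎)
      where
      dec = proj₂ (ordered lam v)
      h = hook lam v
      f = hookCoordinates (FixedHookRow.parts h)

    decode : Fiber HookCore coreWeight n → LHS m n
    decode (f@(k , d , (t , b) , ν) , s , e) = hookPartition f , ∧-intro
      (subst (λ x → T (isPartitionOf x (hookPartition f))) (trans (sum-hookPartition f) e)
             (Decreasing⇒isPartitionOf (proj₂ (Decreasing-hookPartition k d t b ν-dec))))
      (FixedHookRow⇒zfhFrom (hookPartition-fixedHookRow k d t b ν-dec))
      where
      ν-dec = SecondColour⇒Decreasing ν s

    encode∘decode : ∀ x → encode (decode x) ≡ x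
    encode∘decode x@((k , d , (t , b) , ν) , s , _) = Fiber-≡ (begin
      hookCoordinates (FixedHookRow.parts (hook lam v))
        ≡⟨ cong hookCoordinates (FixedHookRow-unique (proj₂ (ordered lam v)) (hook lam v)
                                                     (hookPartition-fixedHookRow k d t b ν-dec)) ⟩
      hookCoordinates (fromGaps (m + k) t , m + k , boxParts m b ++ ν)
        ≡⟨ hookCoordinates-hookPartition k d t b ν-dec ⟩
      k , d , (t , b) , ν ∎)
      where
      lam = proj₁ (decode x)
      v = proj₂ (decode x)
      ν-dec = SecondColour⇒Decreasing ν s

    decode∘encode : ∀ x → decode (encode x) ≡ x
    decode∘encode (lam , v) =
      Σ-≡-irrelevant T-irrelevant (hookPartition-hookCoordinates (proj₂ (ordered lam v)) (hook lam v))

  -- L + 2m − 1 for L = k + 1: parts of μ above L are at least this large.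
  gapBase : ℕ → ℕ
  gapBase k = k + m + m

  gapLength≡ : m + m ∸ 2 ≡ m′ + m′
  gapLength≡ = cong (_∸ 1) (+-suc m′ m′)

  gapBase-beyondGap : ∀ k → suc (suc k + (m′ + m′)) ≡ gapBase k
  gapBase-beyondGap k = shape k m′
    where
    shape : ∀ k m′ → suc (suc k + (m′ + m′)) ≡ k + suc m′ + suc m′
    shape = solve-∀

  L<gapBase : ∀ k → suc k < gapBase k
  L<gapBase k = subst (suc k <_) (gapBase-beyondGap k) (s≤s (s≤s (m≤m+n k (m′ + m′))))

  upperParts : ∀ k {d} → Vec ℕ d → List ℕ
  upperParts k s = fromGaps (gapBase k) s

  lowerParts : ∀ k → Vec ℕ k → List ℕ
  lowerParts k p = replicate (k + m) (suc k) ++ fromMultiplicities p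

  firstColour : ∀ {k d} → PairCore k d → List ℕ
  firstColour {k} (p , s) = upperParts k s ++ lowerParts k p

  upperParts-above : ∀ k {d} (s : Vec ℕ d) → All (suc k <_) (upperParts k s)
  upperParts-above k s =
    All.map (<-≤-trans (L<gapBase k)) (Decreasing⇒≥ (proj₂ (Decreasing-fromGaps (gapBase k) s)))

  Decreasing-lowerParts : ∀ k (p : Vec ℕ k) → Decreasing 1 (suc k) (lowerParts k p)
  Decreasing-lowerParts k p = Decreasing-++ (s≤s z≤n) ≤-refl
    (Decreasing-replicate (k + m) (suc k)) (widen-hi (n≤1+n k) (Decreasing-fromMultiplicities p))

  Decreasing-firstColour : ∀ {k d} (c : PairCore k d) → ∃[ hi ] Decreasing 1 hi (firstColour c)
  Decreasing-firstColour {k} (p , s) =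
    let hi , upper = Decreasing-fromGaps (gapBase k) s in
    hi ⊔ gapBase k ,
    Decreasing-++ (≤-trans (s≤s z≤n) (<⇒≤ (L<gapBase k))) (m≤n⊔m hi (gapBase k))
      (widen-hi (m≤m⊔n hi (gapBase k)) upper) (widen-hi (<⇒≤ (L<gapBase k)) (Decreasing-lowerParts k p))

  sum-firstColour : ∀ {k d} (c : PairCore k d) → sum (firstColour c) ≡ baseSize k d + pairWeight c
  sum-firstColour {k} {d} (p , s) = begin
    sum (upperParts k s ++ lowerParts k p)
      ≡⟨ sum-++ (upperParts k s) _ ⟩
    sum (upperParts k s) + sum (replicate (k + m) (suc k) ++ fromMultiplicities p)
      ≡⟨ cong₂ _+_ (sum-fromGaps (gapBase k) s)
                   (trans (sum-++ (replicate (k + m) (suc k)) _)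
                          (cong₂ _+_ (sum-replicate (k + m) (suc k)) (sum-fromMultiplicities p))) ⟩
    d * gapBase k + weight s + ((k + m) * suc k + weight p)
      ≡⟨ shape k d m (weight p) (weight s) ⟩
    baseSize k d + (weight p + weight s) ∎
    where
    shape : ∀ k d m P S → d * (k + m + m) + S + ((k + m) * suc k + P)
                          ≡ (k + d) * (m + k) + (m + k) + d * m + (P + S)
    shape = solve-∀

  mult-firstColour : ∀ {k d} (c : PairCore k d) → mult (suc k) (firstColour c) ≡ k + m
  mult-firstColour {k} (p , s) = begin
    mult (suc k) (upperParts k s ++ lowerParts k p)
      ≡⟨ mult-++ (suc k) (upperParts k s) _ ⟩
    mult (suc k) (upperParts k s) + mult (suc k) (replicate (k + m) (suc k) ++ fromMultiplicities p)
      ≡⟨ cong₂ _+_ (mult-above (upperParts-above k s)) (mult-++ (suc k) (replicate (k + m) (suc k)) _) ⟩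
    mult (suc k) (replicate (k + m) (suc k)) + mult (suc k) (fromMultiplicities p)
      ≡⟨ cong₂ _+_ (mult-replicate (suc k) (k + m))
                   (mult-below ≤-refl (Decreasing-fromMultiplicities p)) ⟩
    k + m + 0
      ≡⟨ +-identityʳ (k + m) ⟩
    k + m ∎

  gap-firstColour : ∀ {k d} (c : PairCore k d) → All (OutsideGap (suc k) (m′ + m′)) (firstColour c)
  gap-firstColour {k} (p , s) = ++⁺
    (All.map (λ {x} base≤x → inj₂ (subst (_≤ x) (sym (gapBase-beyondGap k)) base≤x))
             (Decreasing⇒≥ (proj₂ (Decreasing-fromGaps (gapBase k) s))))
    (Decreasing⇒All (λ _ x≤L → inj₁ x≤L) (Decreasing-lowerParts k p))

  pairCoreOf : ∀ k d → List ℕ → PairCore k d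
  pairCoreOf k d μ = multiplicities k μ , toGaps d (gapBase k) (takeWhile (suc k <?_) μ)

  pairCoordinates : ℕ → List ℕ → List ℕ → Free PairCore
  pairCoordinates k μ ν = k , d , pairCoreOf k d μ , ν
    where
    d = length (takeWhile (suc k <?_) μ)

  pairCoordinates-firstColour : ∀ {k d} (c : PairCore k d) ν →
    pairCoordinates k (firstColour c) ν ≡ (k , d , c , ν)
  pairCoordinates-firstColour {k} {d} (p , s) ν = begin
    k , length σ , pairCoreOf k (length σ) μ , ν
      ≡⟨ cong (λ d′ → k , d′ , pairCoreOf k d′ μ , ν)
              (trans (cong length upper≡) (length-fromGaps (gapBase k) s)) ⟩
    k , d , (multiplicities k μ , toGaps d (gapBase k) σ) , ν
      ≡⟨ cong₂ (λ p′ s′ → k , d , (p′ , s′) , ν) multiplicities≡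
               (trans (cong (toGaps d (gapBase k)) upper≡) (toGaps-fromGaps (gapBase k) s)) ⟩
    k , d , (p , s) , ν ∎
    where
    μ = firstColour (p , s)
    σ = takeWhile (suc k <?_) μ
    upper≡ : σ ≡ upperParts k s
    upper≡ = takeWhile-++ (upperParts-above k s) (Decreasing-lowerParts k p)
    multiplicities≡ : multiplicities k μ ≡ p
    multiplicities≡ = begin
      multiplicities k μ
        ≡⟨ multiplicities-++-above k _ (All.map (<-trans (n<1+n k)) (upperParts-above k s)) ⟩
      multiplicities k (lowerParts k p)
        ≡⟨ multiplicities-++-above k _ (replicate⁺ (k + m) (n<1+n k)) ⟩
      multiplicities k (fromMultiplicities p)
        ≡⟨ multiplicities-fromMultiplicities p ⟩
      p ∎

  lowerParts-multiplicities : ∀ {k ρ} → Decreasing 1 (suc k) ρ → mult (suc k) ρ ≡ k + m →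
    lowerParts k (multiplicities k ρ) ≡ ρ
  lowerParts-multiplicities {k} {ρ} dec mult≡ with ys , ρ≡ , ys-dec ← peel-largest k ρ dec = begin
    replicate (k + m) (suc k) ++ fromMultiplicities (multiplicities k ρ)
      ≡⟨ cong (λ xs → replicate (k + m) (suc k) ++ fromMultiplicities (multiplicities k xs)) ρ≡ ⟩
    replicate (k + m) (suc k) ++ fromMultiplicities (multiplicities k (replicate c (suc k) ++ ys))
      ≡⟨ cong (λ v → replicate (k + m) (suc k) ++ fromMultiplicities v)
              (multiplicities-++-above k ys (replicate⁺ c (n<1+n k))) ⟩
    replicate (k + m) (suc k) ++ fromMultiplicities (multiplicities k ys)
      ≡⟨ cong₂ (λ c′ zs → replicate c′ (suc k) ++ zs) (sym mult≡)
               (fromMultiplicities-multiplicities k ys-dec) ⟩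
    replicate c (suc k) ++ ys
      ≡⟨ ρ≡ ⟨
    ρ ∎
    where
    c = mult (suc k) ρ

  firstColour-pairCoreOf : ∀ {k hi μ} → Decreasing 1 hi μ → mult (suc k) μ ≡ k + m →
    All (OutsideGap (suc k) (m′ + m′)) μ →
    firstColour (pairCoreOf k (length (takeWhile (suc k <?_) μ)) μ) ≡ μ
  firstColour-pairCoreOf {k} {hi} {μ} dec mult≡ gap = begin
    upperParts k (toGaps (length σ) (gapBase k) σ) ++ lowerParts k (multiplicities k μ)
      ≡⟨ cong₂ (λ a v → a ++ lowerParts k v) (fromGaps-toGaps σ σ-dec refl) multiplicities≡ ⟩
    σ ++ lowerParts k (multiplicities k ρ)
      ≡⟨ cong (σ ++_) (lowerParts-multiplicities (Decreasing-dropWhile dec) multρ) ⟩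
    σ ++ ρ
      ≡⟨ μ≡ ⟩
    μ ∎
    where
    σ = takeWhile (suc k <?_) μ
    ρ = dropWhile (suc k <?_) μ
    σ-above : All (suc k <_) σ
    σ-above = all-takeWhile (suc k <?_) μ
    beyond : ∀ {x} → suc k < x × OutsideGap (suc k) (m′ + m′) x → gapBase k ≤ x
    beyond     (L<x , inj₁ x≤L)   = contradiction L<x (≤⇒≯ x≤L)
    beyond {x} (_   , inj₂ gap<x) = subst (_≤ x) (gapBase-beyondGap k) gap<x
    σ-dec : Decreasing (gapBase k) hi σ
    σ-dec = narrow-lo (All.zipWith beyond (σ-above , takeWhile⁺ (suc k <?_) gap))
                      (Decreasing-takeWhile dec)
    μ≡ : σ ++ ρ ≡ μ
    μ≡ = takeWhile++dropWhile (suc k <?_) μ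
    multiplicities≡ : multiplicities k μ ≡ multiplicities k ρ
    multiplicities≡ = trans (cong (multiplicities k) (sym μ≡))
                            (multiplicities-++-above k ρ (All.map (<-trans (n<1+n k)) σ-above))
    multρ : mult (suc k) ρ ≡ k + m
    multρ = begin
      mult (suc k) ρ                   ≡⟨ cong (_+ mult (suc k) ρ) (mult-above σ-above) ⟨
      mult (suc k) σ + mult (suc k) ρ  ≡⟨ mult-++ (suc k) σ ρ ⟨
      mult (suc k) (σ ++ ρ)            ≡⟨ cong (mult (suc k)) μ≡ ⟩
      mult (suc k) μ                   ≡⟨ mult≡ ⟩
      k + m                            ∎

  fiber↔rhs : ∀ n → Fiber PairCore pairWeight n ↔ RHS m n
  fiber↔rhs n = mk↔ₛ′ decode (proj₁ ∘ preimage) (proj₂ ∘ preimage) encode∘decode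
    where
    decode : Fiber PairCore pairWeight n → RHS m n
    decode ((k , d , c , ν) , s , e) = suc k , firstColour c , ν ,
      ∧-intro (Decreasing⇒isPartitionOf (proj₂ (Decreasing-firstColour c)))
      (∧-intro ν-part
      (∧-intro ν-below
      (∧-intro (≡⇒≡ᵇ _ _ (trans (cong (_+ sum ν) (sum-firstColour c)) e))
      (∧-intro (≡⇒≡ᵇ _ _ (mult-firstColour c))
               (subst (λ K → T (noPartsIn (suc k) K (firstColour c))) (sym gapLength≡)
                      (All⇒noPartsIn (suc k) (m′ + m′) (gap-firstColour c)))))))
      where
      ν-part  = proj₁ (∧-elim {isPartitionOf (sum ν) ν} s)
      ν-below = proj₂ (∧-elim {isPartitionOf (sum ν) ν} s)

    RHS-≡ : {x y : RHS m n} → proj₁ x ≡ proj₁ y → proj₁ (proj₂ x) ≡ proj₁ (proj₂ y) →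
            proj₁ (proj₂ (proj₂ x)) ≡ proj₁ (proj₂ (proj₂ y)) → x ≡ y
    RHS-≡ {L , μ , ν , v} {.L , .μ , .ν , v′} refl refl refl =
      cong (λ v → L , μ , ν , v) (T-irrelevant v v′)

    preimage : (x : RHS m n) → Σ (Fiber PairCore pairWeight n) λ y → decode y ≡ x
    preimage (zero , _ , _ , ())
    preimage (suc k , μ , ν , P) =
      (pairCoordinates k μ ν , ∧-intro ν-part ν-below , size≡) , RHS-≡ refl μ≡ refl
      where
      μ-part  = proj₁ (∧-elim {isPartitionOf (sum μ) μ} P)
      P₁      = proj₂ (∧-elim {isPartitionOf (sum μ) μ} P)
      ν-part  = proj₁ (∧-elim {isPartitionOf (sum ν) ν} P₁)
      P₂      = proj₂ (∧-elim {isPartitionOf (sum ν) ν} P₁)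
      ν-below = proj₁ (∧-elim {partsBelow m ν} P₂)
      P₃      = proj₂ (∧-elim {partsBelow m ν} P₂)
      total   = ≡ᵇ⇒≡ _ _ (proj₁ (∧-elim {sum μ + sum ν ≡ᵇ n} P₃))
      P₄      = proj₂ (∧-elim {sum μ + sum ν ≡ᵇ n} P₃)
      mult≡   = ≡ᵇ⇒≡ _ _ (proj₁ (∧-elim {mult (suc k) μ ≡ᵇ (k + m)} P₄))
      noParts = proj₂ (∧-elim {mult (suc k) μ ≡ᵇ (k + m)} P₄)
      gap     = noPartsIn⇒All (suc k) (m′ + m′)
                  (subst (λ K → T (noPartsIn (suc k) K μ)) gapLength≡ noParts)
      d = length (takeWhile (suc k <?_) μ)
      μ≡ : firstColour (pairCoreOf k d μ) ≡ μ
      μ≡ = firstColour-pairCoreOf (proj₂ (isPartitionOf⇒Decreasing μ μ-part)) mult≡ gap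
      size≡ : size pairWeight (pairCoordinates k μ ν) ≡ n
      size≡ = begin
        baseSize k d + pairWeight (pairCoreOf k d μ) + sum ν
          ≡⟨ cong (_+ sum ν) (sum-firstColour (pairCoreOf k d μ)) ⟨
        sum (firstColour (pairCoreOf k d μ)) + sum ν
          ≡⟨ cong (λ xs → sum xs + sum ν) μ≡ ⟩
        sum μ + sum ν
          ≡⟨ total ⟩
        n ∎

    encode∘decode : ∀ y → proj₁ (preimage (decode y)) ≡ y
    encode∘decode ((k , d , c , ν) , _) = Fiber-≡ (pairCoordinates-firstColour c ν)

theorem1p1 : (m n : ℕ) → m ≥ 1 → LHS m n ↔ RHS m n
theorem1p1 zero      n ()
theorem1p1 (suc m′) n _ = ↔-trans (lhs↔fiber n) (↔-trans (fiber-hook↔pair n) (fiber↔rhs n))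
  where open Column m′
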